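{- Let $k$ be a positive integer and let $G$ be a $C_{2k+1}$-critical series-parallel graph. Then: (i) $G$ is $2$-connected; (ii) if $\{s,t\}$ is a vertex cut of $G$ and $H$ is a component of $G-\{s,t\}$, then $(G[V(H)\cup\{s,t\}],s,t)$ is a restricted $(s,t)$-terminal series-parallel graph.
   Context: $V(C_{2k+1})=\mathbb{Z}_{2k+1}$ with $u\sim v$ iff $u-v=\pm1$; a $C_{2k+1}$-colouring of $G$ is a map $\phi:V(G)\to\mathbb{Z}_{2k+1}$ with $\phi(u)-\phi(v)=\pm1$ on every edge. $G$ is $C_{2k+1}$-critical if it has no $C_{2k+1}$-colouring but every proper subgraph has one. A 2-terminal graph $(G,s,t)$ has two distinct distinguished vertices; serial sum $(G_1,s_1,t_1)+(G_2,s_2,t_2)$ identifies $t_1$ with $s_2$ (terminals $s_1,t_2$), parallel sum identifies $s_1$ with $s_2$ and $t_1$ with $t_2$. $G$ is series-parallel if for some terminals it can be built from single edges by these sums. The forced set of $(G,s,t)$ is $\{x\in\mathbb{Z}_{2k+1}:\exists$ a $C_{2k+1}$-colouring $\phi$ of $G$ with $\phi(s)=0,\phi(t)=x\}$; $(G,s,t)$ with nonempty forced set $S$ is restricted if $S\ne\mathbb{Z}_{2k+1}$. -}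

module Defs where

open import Data.Nat using (ℕ; suc; _*_; _≤_)
open import Data.Nat.DivMod using (_mod_)
open import Data.Fin using (Fin; toℕ; zero)
open import Data.Product using (Σ; ∃; _×_; _,_)
open import Data.Sum using (_⊎_)
open import Data.Unit using (⊤)
open import Relation.Nullary using (¬_)
open import Relation.Binary.PropositionalEquality using (_≡_; _≢_)

ℤ[_] : ℕ → Set
ℤ[ k ] = Fin (suc (2 * k))

next : (k : ℕ) → ℤ[ k ] → ℤ[ k ]
next k a = suc (toℕ a) mod suc (2 * k)

CAdj : (k : ℕ) → ℤ[ k ] → ℤ[ k ] → Set
CAdj k a b = (b ≡ next k a) ⊎ (a ≡ next k b)

VPred : ℕ → Set₁
VPred n = Fin n → Set

EPred : ℕ → Set₁
EPred n = Fin n → Fin n → Set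

_≐_ : ∀ {n} → VPred n → VPred n → Set
P ≐ Q = ∀ x → (P x → Q x) × (Q x → P x)

_≐₂_ : ∀ {n} → EPred n → EPred n → Set
P ≐₂ Q = ∀ x y → (P x y → Q x y) × (Q x y → P x y)

record Graph (n : ℕ) : Set₁ where
  field
    E     : EPred n
    sym   : ∀ u v → E u v → E v u
    irrfl : ∀ u → ¬ E u u
open Graph public

-- C_{2k+1}-colourings of the graph with vertex set V and edge set E
-- (a colouring is given on all of Fin n; values outside V are irrelevant).

IsColouring : (k : ℕ) {n : ℕ} → EPred n → (Fin n → ℤ[ k ]) → Set
IsColouring k E φ = ∀ u v → E u v → CAdj k (φ u) (φ v)

Colourable : (k : ℕ) {n : ℕ} → EPred n → Set
Colourable k {n} E = Σ (Fin n → ℤ[ k ]) (IsColouring k E)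

-- (V' , E') is a subgraph of G (whose vertex set is all of Fin n)
record Subgraph {n : ℕ} (G : Graph n) : Set₁ where
  field
    V'    : VPred n
    E'    : EPred n
    E'⊆E  : ∀ u v → E' u v → E G u v
    E'⊆V' : ∀ u v → E' u v → V' u × V' v
open Subgraph public

Proper : ∀ {n} {G : Graph n} → Subgraph G → Set
Proper {n} {G} H = ¬ ((∀ v → V' H v) × (∀ u v → E G u v → E' H u v))

Critical : (k : ℕ) {n : ℕ} → Graph n → Set₁
Critical k G = ¬ Colourable k (E G)
             × ((H : Subgraph G) → Proper H → Colourable k (E' H))

-- Series-parallel 2-terminal graphs, realised inside the ambient vertex
-- set Fin n.  SP V E s t : the graph (V , E) with terminals s , t is
-- built from single edges by serial and parallel sums.

_∪_ : ∀ {n} → VPred n → VPred n → VPred n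
(P ∪ Q) x = P x ⊎ Q x

_∪₂_ : ∀ {n} → EPred n → EPred n → EPred n
(P ∪₂ Q) x y = P x y ⊎ Q x y

data SP {n : ℕ} : VPred n → EPred n → Fin n → Fin n → Set₁ where
  edge     : ∀ {V E s t} → s ≢ t
           → V ≐ (λ x → x ≡ s ⊎ x ≡ t)
           → E ≐₂ (λ x y → (x ≡ s × y ≡ t) ⊎ (x ≡ t × y ≡ s))
           → SP V E s t
  series   : ∀ {V E V₁ E₁ V₂ E₂ s m t}
           → SP V₁ E₁ s m → SP V₂ E₂ m t
           → (∀ x → V₁ x → V₂ x → x ≡ m)
           → V ≐ (V₁ ∪ V₂) → E ≐₂ (E₁ ∪₂ E₂)
           → SP V E s t
  parallel : ∀ {V E V₁ E₁ V₂ E₂ s t}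
           → SP V₁ E₁ s t → SP V₂ E₂ s t
           → (∀ x → V₁ x → V₂ x → x ≡ s ⊎ x ≡ t)
           → V ≐ (V₁ ∪ V₂) → E ≐₂ (E₁ ∪₂ E₂)
           → SP V E s t

SeriesParallel : ∀ {n} → Graph n → Set₁
SeriesParallel {n} G = Σ (Fin n) λ s → Σ (Fin n) λ t → SP (λ _ → ⊤) (E G) s t

data Reach {n : ℕ} (E : EPred n) (W : VPred n) : Fin n → Fin n → Set where
  here : ∀ {u} → W u → Reach E W u u
  step : ∀ {u v w} → Reach E W u v → E v w → W w → Reach E W u w

Connected : ∀ {n} → Graph n → VPred n → Set
Connected G W = ∀ u v → W u → W v → Reach (E G) W u v

TwoConnected : ∀ {n} → Graph n → Set
TwoConnected {n} G = (3 ≤ n) × Connected G (λ _ → ⊤)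
                   × (∀ x → Connected G (λ v → v ≢ x))

Minus2 : ∀ {n} → Fin n → Fin n → VPred n
Minus2 s t v = (v ≢ s) × (v ≢ t)

VertexCut : ∀ {n} → Graph n → Fin n → Fin n → Set
VertexCut G s t = (s ≢ t) × ¬ Connected G (Minus2 s t)

Component : ∀ {n} → Graph n → Fin n → Fin n → Fin n → VPred n
Component G s t h = Reach (E G) (Minus2 s t) h

InducedE : ∀ {n} → Graph n → VPred n → EPred n
InducedE G W u v = W u × W v × E G u v

Forced : (k : ℕ) {n : ℕ} → EPred n → Fin n → Fin n → ℤ[ k ] → Set
Forced k E s t x = Σ (_ → ℤ[ k ]) λ φ → IsColouring k E φ × (φ s ≡ zero) × (φ t ≡ x)

Restricted : (k : ℕ) {n : ℕ} → EPred n → Fin n → Fin n → Set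
Restricted k E s t = (∃ λ x → Forced k E s t x) × (∃ λ x → ¬ Forced k E s t x)

-- Colourings of C_{2k+1} can be rotated so that any chosen vertex gets any chosen colour, and two colourings
-- that agree on a separator glue.  As every proper subgraph of a critical graph G is colourable, the last
-- step of a series-parallel decomposition of G is neither an edge nor a serial sum, so it is a parallel sum;
-- a vertex x lies in at most one of its two parts away from the terminals, and the other part links the
-- terminals avoiding x, giving 2-connectivity.  For a 2-cut {s, t} and a component H of G − {s, t}: G[H ∪ {s, t}] is proper, so its forced
-- set is nonempty; a colouring of G − H with s ↦ 0 gives t a colour outside it, or the two would glue into a
-- colouring of G.  Finally G[H ∪ {s, t}] is series-parallel between s and t: rerooting the decomposition of G
-- at an edge from {s, t} into another component makes H avoid both terminals, and by induction on the
-- decomposition such a bridge is either confined to one part or, in a serial sum, consists of the sides cut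
-- off at the middle vertex by s in one half and by t in the other, each of which is series-parallel.

module Submission where

open import Defs hiding (E; sym)
open import Data.Empty using (⊥-elim)
open import Data.Fin using (Fin; toℕ; zero; suc; _≟_)
open import Data.Fin.Properties using (toℕ-fromℕ<; toℕ-injective; toℕ<n; any?; ¬∀⟶∃¬)
open import Data.Fin.Subset using (Subset; _∈_; _-_; _⊂_)
open import Data.Fin.Subset.Induction using (⊂-wellFounded)
open import Data.Fin.Subset.Properties using (_∈?_; p─q⊆p; x∈p⇒p-x⊂p; x∈p∧x≢y⇒x∈p-y)
open import Data.Nat using (ℕ; suc; _+_; _*_; _∸_; _≤_; _≤?_; NonZero; z≤n; s≤s; s≤s⁻¹)
open import Data.Nat.DivMod using (_%_; _mod_; %-distribˡ-+; m%n%n≡m%n; %-remove-+ˡ; m<n⇒m%n≡m)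
open import Data.Nat.Divisibility using (∣-refl)
open import Data.Nat.Properties using (+-comm; +-assoc; m+[n∸m]≡n; <⇒≤; ≰⇒>)
open import Data.Product using (Σ; ∃; _×_; _,_; proj₁; proj₂)
open import Data.Sum using (_⊎_; inj₁; inj₂; [_,_]; [_,_]′; swap) renaming (map to ⊎-map)
open import Data.Unit using (⊤; tt)
open import Data.Vec using (tabulate)
open import Data.Vec.Properties using (lookup⇒[]=; []=⇒lookup; lookup∘tabulate)
open import Function using (id; _∘_)
open import Induction.WellFounded using (Acc; acc)
open import Relation.Nullary using (¬_; Dec; yes; no; does)
open import Relation.Nullary.Decidable using (_×-dec_; _⊎-dec_; ¬?; _→-dec_; map′; dec-true)
open import Relation.Unary using (_⊆′_; _∩_; Decidable)
open import Relation.Binary.PropositionalEquality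
  using (_≡_; _≢_; refl; sym; trans; cong; subst; subst₂; module ≡-Reasoning)

private
  variable
    k n : ℕ
    u v w x y z s t m h : Fin n
    V W X V₁ V₂ : VPred n
    E F E₁ E₂ : EPred n

toℕ-mod : ∀ m d .{{_ : NonZero d}} → toℕ (m mod d) ≡ m % d
toℕ-mod m d = toℕ-fromℕ< _

[m%d+n]%d≡[m+n]%d : ∀ m n d .{{_ : NonZero d}} → (m % d + n) % d ≡ (m + n) % d
[m%d+n]%d≡[m+n]%d m n d = begin
  (m % d + n) % d            ≡⟨ %-distribˡ-+ (m % d) n d ⟩
  (m % d % d + n % d) % d    ≡⟨ cong (λ z → (z + n % d) % d) (m%n%n≡m%n m d) ⟩
  (m % d + n % d) % d        ≡⟨ %-distribˡ-+ m n d ⟨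
  (m + n) % d                ∎
  where open ≡-Reasoning

module _ (k : ℕ) where
  private
    N : ℕ
    N = suc (2 * k)

  rotate : ℕ → ℤ[ k ] → ℤ[ k ]
  rotate c a = (toℕ a + c) mod N

  rotate-next : ∀ c a → rotate c (next k a) ≡ next k (rotate c a)
  rotate-next c a = toℕ-injective (begin
    toℕ (rotate c (next k a))        ≡⟨ toℕ-mod (toℕ (next k a) + c) N ⟩
    (toℕ (next k a) + c) % N         ≡⟨ cong (λ z → (z + c) % N) (toℕ-mod (suc (toℕ a)) N) ⟩
    (suc (toℕ a) % N + c) % N        ≡⟨ [m%d+n]%d≡[m+n]%d (suc (toℕ a)) c N ⟩
    suc (toℕ a + c) % N              ≡⟨ cong (_% N) (+-comm 1 (toℕ a + c)) ⟩
    (toℕ a + c + 1) % N              ≡⟨ [m%d+n]%d≡[m+n]%d (toℕ a + c) 1 N ⟨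
    ((toℕ a + c) % N + 1) % N        ≡⟨ cong (λ z → (z + 1) % N) (toℕ-mod (toℕ a + c) N) ⟨
    (toℕ (rotate c a) + 1) % N       ≡⟨ cong (_% N) (+-comm _ 1) ⟩
    suc (toℕ (rotate c a)) % N       ≡⟨ toℕ-mod (suc (toℕ (rotate c a))) N ⟨
    toℕ (next k (rotate c a))        ∎)
    where open ≡-Reasoning

  rotate-onto : ∀ a b → ∃ λ c → rotate c a ≡ b
  rotate-onto a b = N ∸ toℕ a + toℕ b , toℕ-injective (begin
    toℕ (rotate (N ∸ toℕ a + toℕ b) a)  ≡⟨ toℕ-mod (toℕ a + (N ∸ toℕ a + toℕ b)) N ⟩
    (toℕ a + (N ∸ toℕ a + toℕ b)) % N  ≡⟨ cong (_% N) (+-assoc (toℕ a) _ _) ⟨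
    (toℕ a + (N ∸ toℕ a) + toℕ b) % N  ≡⟨ cong (λ z → (z + toℕ b) % N) (m+[n∸m]≡n (<⇒≤ (toℕ<n a))) ⟩
    (N + toℕ b) % N                    ≡⟨ %-remove-+ˡ (toℕ b) ∣-refl ⟩
    toℕ b % N                          ≡⟨ m<n⇒m%n≡m (toℕ<n b) ⟩
    toℕ b                              ∎)
    where open ≡-Reasoning

  CAdj-rotate : ∀ c {a b} → CAdj k a b → CAdj k (rotate c a) (rotate c b)
  CAdj-rotate c (inj₁ refl) = inj₁ (rotate-next c _)
  CAdj-rotate c (inj₂ refl) = inj₂ (rotate-next c _)

  recolour : {φ : Fin n → ℤ[ k ]} → IsColouring k E φ → ∀ x b →
             Σ (Fin n → ℤ[ k ]) λ ψ → IsColouring k E ψ × ψ x ≡ b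
  recolour {φ = φ} col x b with rotate-onto (φ x) b
  ... | c , rotated = rotate c ∘ φ , (λ u v e → CAdj-rotate c (col u v e)) , rotated

module _ {A : Set} {P : VPred n} (P? : Decidable P) (φ ψ : Fin n → A) where

  splice : Fin n → A
  splice x with P? x
  ... | yes _ = φ x
  ... | no _  = ψ x

  splice-≡ˡ : P x ⊎ φ x ≡ ψ x → splice x ≡ φ x
  splice-≡ˡ {x = x} inside-or-agree with P? x
  ... | yes _  = refl
  ... | no ¬Px = [ ⊥-elim ∘ ¬Px , sym ] inside-or-agree

  splice-≡ʳ : ¬ P x ⊎ φ x ≡ ψ x → splice x ≡ ψ x
  splice-≡ʳ {x = x} outside-or-agree with P? x
  ... | yes Px = [ (λ ¬Px → ⊥-elim (¬Px Px)) , id ] outside-or-agree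
  ... | no _   = refl

splice-isColouring : ∀ k {P : VPred n} (P? : Decidable P) {φ ψ : Fin n → ℤ[ k ]} →
  IsColouring k E₁ φ → IsColouring k E₂ ψ →
  (∀ x y → E x y → (E₁ x y × (P x ⊎ φ x ≡ ψ x) × (P y ⊎ φ y ≡ ψ y))
                 ⊎ (E₂ x y × (¬ P x ⊎ φ x ≡ ψ x) × (¬ P y ⊎ φ y ≡ ψ y))) →
  IsColouring k E (splice P? φ ψ)
splice-isColouring k P? {φ} {ψ} φ-col ψ-col sides x y e with sides x y e
... | inj₁ (e₁ , gx , gy) = subst₂ (CAdj k) (sym (splice-≡ˡ P? φ ψ gx)) (sym (splice-≡ˡ P? φ ψ gy)) (φ-col x y e₁)
... | inj₂ (e₂ , gx , gy) = subst₂ (CAdj k) (sym (splice-≡ʳ P? φ ψ gx)) (sym (splice-≡ʳ P? φ ψ gy)) (ψ-col x y e₂)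

_⊆₂_ : EPred n → EPred n → Set
E ⊆₂ F = ∀ x y → E x y → F x y

⊆₂-refl : E ⊆₂ E
⊆₂-refl _ _ e = e

Colourable-mono : F ⊆₂ E → Colourable k E → Colourable k F
Colourable-mono F⊆E (φ , col) = φ , λ u v e → col u v (F⊆E u v e)

_∖_ : VPred n → Fin n → VPred n
(W ∖ x) z = W z × z ≢ x

Reach-endpoints : Reach E W u v → W u × W v
Reach-endpoints (here w)     = w , w
Reach-endpoints (step r _ w) = proj₁ (Reach-endpoints r) , w

¬Reach-removed : ¬ Reach E (W ∖ x) y x
¬Reach-removed r = proj₂ (proj₂ (Reach-endpoints r)) refl

Reach-map : W ⊆′ X → E ⊆₂ F → Reach E W u v → Reach F X u v
Reach-map f g (here w)     = here (f _ w)
Reach-map f g (step r e w) = step (Reach-map f g r) (g _ _ e) (f _ w)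

Reach-trans : Reach E W u v → Reach E W v w → Reach E W u w
Reach-trans r (here _)       = r
Reach-trans r (step r′ e w)  = step (Reach-trans r r′) e w

Reach-cons : E u v → W u → Reach E W v w → Reach E W u w
Reach-cons e wu r = Reach-trans (step (here wu) e (proj₁ (Reach-endpoints r))) r

Reach-sym : (∀ x y → E x y → E y x) → Reach E W u v → Reach E W v u
Reach-sym E-sym (here w)     = here w
Reach-sym E-sym (step r e w) = Reach-cons (E-sym _ _ e) w (Reach-sym E-sym r)

Reach-uncons : Reach E W u v → u ≡ v ⊎ ∃ λ w → E u w × Reach E (W ∖ u) w v
Reach-uncons {u = u} (step {w = y} r e Wy) with Reach-uncons r | y ≟ u
... | _                   | yes y≡u = inj₁ (sym y≡u)
... | inj₁ refl           | no y≢u  = inj₂ (y , e , here (Wy , y≢u))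
... | inj₂ (w , e₀ , r′)  | no y≢u  = inj₂ (w , e₀ , step r′ e (Wy , y≢u))
Reach-uncons (here _) = inj₁ refl

Reach-closed : (P : VPred n) → P u → (∀ {x y} → P x → E x y → W y → P y) → Reach E W u v → P v
Reach-closed P Pu closed (here _)     = Pu
Reach-closed P Pu closed (step r e w) = closed (Reach-closed P Pu closed r) e w

Reach-exit : (C : VPred n) → Decidable C → Reach E W u v → C u → ¬ C v →
             ∃ λ x → ∃ λ y → C x × ¬ C y × E x y × W y
Reach-exit C C? (here _) Cu ¬Cv = ⊥-elim (¬Cv Cu)
Reach-exit C C? (step {v = x} {w = y} r e w) Cu ¬Cy with C? x
... | yes Cx = x , y , Cx , ¬Cy , e , w
... | no ¬Cx = Reach-exit C C? r Cu ¬Cx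

toSubset : {W : VPred n} → Decidable W → Subset n
toSubset W? = tabulate (does ∘ W?)

∈-toSubset⁺ : (W? : Decidable W) → W x → x ∈ toSubset W?
∈-toSubset⁺ {x = x} W? Wx = lookup⇒[]= x _ (trans (lookup∘tabulate (does ∘ W?) x) (dec-true (W? x) Wx))

∈-toSubset⁻ : (W? : Decidable W) → x ∈ toSubset W? → W x
∈-toSubset⁻ {x = x} W? x∈ with W? x | trans (sym (lookup∘tabulate (does ∘ W?) x)) ([]=⇒lookup x∈)
... | yes Wx | _ = Wx
... | no _   | ()

module _ {n : ℕ} {E : EPred n} (E? : ∀ x y → Dec (E x y)) where

  Reach-dec-Subset : (S : Subset n) → Acc _⊂_ S → ∀ u v → Dec (Reach E (_∈ S) u v)
  Reach-dec-Subset S (acc smaller) u v with u ∈? S | u ≟ v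
  ... | no u∉S | _        = no (u∉S ∘ proj₁ ∘ Reach-endpoints)
  ... | yes u∈S | yes refl = yes (here u∈S)
  ... | yes u∈S | no u≢v  = map′ through-neighbour via-first-step
        (any? λ w → E? u w ×-dec Reach-dec-Subset (S - u) (smaller (x∈p⇒p-x⊂p u∈S)) w v)
    where
    through-neighbour : (∃ λ w → E u w × Reach E (_∈ S - u) w v) → Reach E (_∈ S) u v
    through-neighbour (w , e , r) = Reach-cons e u∈S (Reach-map (λ _ → p─q⊆p S _) ⊆₂-refl r)

    via-first-step : Reach E (_∈ S) u v → ∃ λ w → E u w × Reach E (_∈ S - u) w v
    via-first-step r with Reach-uncons r
    ... | inj₁ u≡v = ⊥-elim (u≢v u≡v)
    ... | inj₂ (w , e , r′) = w , e , Reach-map (λ _ (x∈S , x≢u) → x∈p∧x≢y⇒x∈p-y x∈S x≢u) ⊆₂-refl r′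

  Reach-dec : {W : VPred n} → Decidable W → ∀ u v → Dec (Reach E W u v)
  Reach-dec W? u v = map′ (Reach-map (λ _ → ∈-toSubset⁻ W?) ⊆₂-refl) (Reach-map (λ _ → ∈-toSubset⁺ W?) ⊆₂-refl)
    (Reach-dec-Subset (toSubset W?) (⊂-wellFounded _) u v)

≐-to : V ≐ W → V x → W x
≐-to eq = proj₁ (eq _)

≐-from : V ≐ W → W x → V x
≐-from eq = proj₂ (eq _)

≐₂-to : E ≐₂ F → E x y → F x y
≐₂-to eq = proj₁ (eq _ _)

≐₂-from : E ≐₂ F → F x y → E x y
≐₂-from eq = proj₂ (eq _ _)

≐-refl : V ≐ V
≐-refl _ = id , id

≐-sym : V ≐ W → W ≐ V
≐-sym eq _ = ≐-from eq , ≐-to eq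

≐-trans : V ≐ W → W ≐ X → V ≐ X
≐-trans eq eq′ _ = ≐-to eq′ ∘ ≐-to eq , ≐-from eq ∘ ≐-from eq′

≐₂-refl : E ≐₂ E
≐₂-refl _ _ = id , id

≐₂-sym : E ≐₂ F → F ≐₂ E
≐₂-sym eq _ _ = ≐₂-from eq , ≐₂-to eq

≐₂-trans : {G : EPred n} → E ≐₂ F → F ≐₂ G → E ≐₂ G
≐₂-trans eq eq′ _ _ = ≐₂-to eq′ ∘ ≐₂-to eq , ≐₂-from eq ∘ ≐₂-from eq′

∪-comm : (V ∪ W) ≐ (W ∪ V)
∪-comm _ = swap , swap

∪₂-comm : (E ∪₂ F) ≐₂ (F ∪₂ E)
∪₂-comm _ _ = swap , swap

Dec-≐ : V ≐ W → Decidable W → Decidable V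
Dec-≐ eq W? x = map′ (≐-from eq) (≐-to eq) (W? x)

Pair : Fin n → Fin n → VPred n
Pair s t x = x ≡ s ⊎ x ≡ t

Induced : EPred n → VPred n → EPred n
Induced E W x y = W x × W y × E x y

SP-resp : V ≐ W → E ≐₂ F → SP V E s t → SP W F s t
SP-resp eqV eqE (edge s≢t V≐ E≐)          = edge s≢t (≐-trans (≐-sym eqV) V≐) (≐₂-trans (≐₂-sym eqE) E≐)
SP-resp eqV eqE (series D₁ D₂ meet V≐ E≐)   = series D₁ D₂ meet (≐-trans (≐-sym eqV) V≐) (≐₂-trans (≐₂-sym eqE) E≐)
SP-resp eqV eqE (parallel D₁ D₂ meet V≐ E≐) = parallel D₁ D₂ meet (≐-trans (≐-sym eqV) V≐) (≐₂-trans (≐₂-sym eqE) E≐)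

SP-terminals : SP V E s t → V s × V t
SP-terminals (edge _ V≐ _)            = ≐-from V≐ (inj₁ refl) , ≐-from V≐ (inj₂ refl)
SP-terminals (series D₁ D₂ _ V≐ _)    =
  ≐-from V≐ (inj₁ (proj₁ (SP-terminals D₁))) , ≐-from V≐ (inj₂ (proj₂ (SP-terminals D₂)))
SP-terminals (parallel D₁ _ _ V≐ _)   =
  ≐-from V≐ (inj₁ (proj₁ (SP-terminals D₁))) , ≐-from V≐ (inj₁ (proj₂ (SP-terminals D₁)))

SP-source : SP V E s t → V s
SP-source = proj₁ ∘ SP-terminals

SP-target : SP V E s t → V t
SP-target = proj₂ ∘ SP-terminals

SP-edge-ends : SP V E s t → E x y → V x × V y
SP-edge-ends (edge _ V≐ E≐) e with ≐₂-to E≐ e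
... | inj₁ (refl , refl) = ≐-from V≐ (inj₁ refl) , ≐-from V≐ (inj₂ refl)
... | inj₂ (refl , refl) = ≐-from V≐ (inj₂ refl) , ≐-from V≐ (inj₁ refl)
SP-edge-ends (series D₁ D₂ _ V≐ E≐) e with ≐₂-to E≐ e
... | inj₁ e₁ = let x₁ , y₁ = SP-edge-ends D₁ e₁ in ≐-from V≐ (inj₁ x₁) , ≐-from V≐ (inj₁ y₁)
... | inj₂ e₂ = let x₂ , y₂ = SP-edge-ends D₂ e₂ in ≐-from V≐ (inj₂ x₂) , ≐-from V≐ (inj₂ y₂)
SP-edge-ends (parallel D₁ D₂ _ V≐ E≐) e with ≐₂-to E≐ e
... | inj₁ e₁ = let x₁ , y₁ = SP-edge-ends D₁ e₁ in ≐-from V≐ (inj₁ x₁) , ≐-from V≐ (inj₁ y₁)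
... | inj₂ e₂ = let x₂ , y₂ = SP-edge-ends D₂ e₂ in ≐-from V≐ (inj₂ x₂) , ≐-from V≐ (inj₂ y₂)

SP-sym : SP V E s t → E x y → E y x
SP-sym (edge _ _ E≐) e with ≐₂-to E≐ e
... | inj₁ (refl , refl) = ≐₂-from E≐ (inj₂ (refl , refl))
... | inj₂ (refl , refl) = ≐₂-from E≐ (inj₁ (refl , refl))
SP-sym (series D₁ D₂ _ _ E≐) e   = ≐₂-from E≐ ([ inj₁ ∘ SP-sym D₁ , inj₂ ∘ SP-sym D₂ ] (≐₂-to E≐ e))
SP-sym (parallel D₁ D₂ _ _ E≐) e = ≐₂-from E≐ ([ inj₁ ∘ SP-sym D₁ , inj₂ ∘ SP-sym D₂ ] (≐₂-to E≐ e))

SP-terminals-distinct : SP V E s t → s ≢ t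
SP-terminals-distinct (edge s≢t _ _)          = s≢t
SP-terminals-distinct (series D₁ D₂ meet _ _) refl =
  SP-terminals-distinct D₁ (meet _ (SP-source D₁) (SP-target D₂))
SP-terminals-distinct (parallel D₁ _ _ _ _)   = SP-terminals-distinct D₁

SP-irrefl : SP V E s t → ¬ E x x
SP-irrefl (edge s≢t _ E≐) e with ≐₂-to E≐ e
... | inj₁ (refl , refl) = s≢t refl
... | inj₂ (refl , refl) = s≢t refl
SP-irrefl (series D₁ D₂ _ _ E≐)   = [ SP-irrefl D₁ , SP-irrefl D₂ ] ∘ ≐₂-to E≐
SP-irrefl (parallel D₁ D₂ _ _ E≐) = [ SP-irrefl D₁ , SP-irrefl D₂ ] ∘ ≐₂-to E≐

SP-dec-V : SP V E s t → Decidable V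
SP-dec-V (edge {s = s} {t = t} _ V≐ _) = Dec-≐ V≐ λ x → x ≟ s ⊎-dec x ≟ t
SP-dec-V (series D₁ D₂ _ V≐ _)         = Dec-≐ V≐ λ x → SP-dec-V D₁ x ⊎-dec SP-dec-V D₂ x
SP-dec-V (parallel D₁ D₂ _ V≐ _)       = Dec-≐ V≐ λ x → SP-dec-V D₁ x ⊎-dec SP-dec-V D₂ x

SP-dec-E : SP V E s t → ∀ x y → Dec (E x y)
SP-dec-E (edge {s = s} {t = t} _ _ E≐) x y =
  map′ (≐₂-from E≐) (≐₂-to E≐) ((x ≟ s ×-dec y ≟ t) ⊎-dec (x ≟ t ×-dec y ≟ s))
SP-dec-E (series D₁ D₂ _ _ E≐) x y   = map′ (≐₂-from E≐) (≐₂-to E≐) (SP-dec-E D₁ x y ⊎-dec SP-dec-E D₂ x y)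
SP-dec-E (parallel D₁ D₂ _ _ E≐) x y = map′ (≐₂-from E≐) (≐₂-to E≐) (SP-dec-E D₁ x y ⊎-dec SP-dec-E D₂ x y)

SP-reverse : SP V E s t → SP V E t s
SP-reverse (edge s≢t V≐ E≐) =
  edge (s≢t ∘ sym) (≐-trans V≐ ∪-comm) (≐₂-trans E≐ ∪₂-comm)
SP-reverse (series D₁ D₂ meet V≐ E≐) =
  series (SP-reverse D₂) (SP-reverse D₁) (λ x x₂ x₁ → meet x x₁ x₂) (≐-trans V≐ ∪-comm) (≐₂-trans E≐ ∪₂-comm)
SP-reverse (parallel D₁ D₂ meet V≐ E≐) =
  parallel (SP-reverse D₁) (SP-reverse D₂) (λ x x₁ x₂ → swap (meet x x₁ x₂)) V≐ E≐

≐∪-inj₁ : V ≐ (V₁ ∪ V₂) → V₁ ⊆′ V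
≐∪-inj₁ V≐ _ = ≐-from V≐ ∘ inj₁

≐∪-inj₂ : V ≐ (V₁ ∪ V₂) → V₂ ⊆′ V
≐∪-inj₂ V≐ _ = ≐-from V≐ ∘ inj₂

≐∪₂-inj₁ : E ≐₂ (E₁ ∪₂ E₂) → E₁ ⊆₂ E
≐∪₂-inj₁ E≐ _ _ = ≐₂-from E≐ ∘ inj₁

≐∪₂-inj₂ : E ≐₂ (E₁ ∪₂ E₂) → E₂ ⊆₂ E
≐∪₂-inj₂ E≐ _ _ = ≐₂-from E≐ ∘ inj₂

∖-mono : V ⊆′ W → (V ∖ x) ⊆′ (W ∖ x)
∖-mono V⊆W z (Vz , z≢x) = V⊆W z Vz , z≢x

⊆∖ : ¬ V x → V ⊆′ (V ∖ x)
⊆∖ ¬Vx _ Vz = Vz , λ { refl → ¬Vx Vz }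

SP-reaches-target : SP V E s t → V w → Reach E V w t
SP-reaches-target (edge _ V≐ E≐) Vw with ≐-to V≐ Vw
... | inj₁ refl = step (here Vw) (≐₂-from E≐ (inj₁ (refl , refl))) (≐-from V≐ (inj₂ refl))
... | inj₂ refl = here Vw
SP-reaches-target (series D₁ D₂ _ V≐ E≐) Vw with ≐-to V≐ Vw
... | inj₁ w₁ = Reach-trans (Reach-map (≐∪-inj₁ V≐) (≐∪₂-inj₁ E≐) (SP-reaches-target D₁ w₁))
                            (Reach-map (≐∪-inj₂ V≐) (≐∪₂-inj₂ E≐) (SP-reaches-target D₂ (SP-source D₂)))
... | inj₂ w₂ = Reach-map (≐∪-inj₂ V≐) (≐∪₂-inj₂ E≐) (SP-reaches-target D₂ w₂)
SP-reaches-target (parallel D₁ D₂ _ V≐ E≐) Vw with ≐-to V≐ Vw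
... | inj₁ w₁ = Reach-map (≐∪-inj₁ V≐) (≐∪₂-inj₁ E≐) (SP-reaches-target D₁ w₁)
... | inj₂ w₂ = Reach-map (≐∪-inj₂ V≐) (≐∪₂-inj₂ E≐) (SP-reaches-target D₂ w₂)

SP-reaches-source : SP V E s t → V w → Reach E V w s
SP-reaches-source = SP-reaches-target ∘ SP-reverse

SP-connected : SP V E s t → V x → V y → Reach E V x y
SP-connected D Vx Vy =
  Reach-trans (SP-reaches-source D Vx) (Reach-sym (λ _ _ → SP-sym D) (SP-reaches-source D Vy))

private
  series-avoid : SP V₁ E₁ s m → SP V₂ E₂ m t → (∀ z → V₁ z → V₂ z → z ≡ m) →
                 V ≐ (V₁ ∪ V₂) → E ≐₂ (E₁ ∪₂ E₂) → V₁ w →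
                 Reach E₁ (V₁ ∖ x) w s ⊎ Reach E₁ (V₁ ∖ x) w m →
                 Reach E (V ∖ x) w s ⊎ Reach E (V ∖ x) w t
  series-avoid D₁ D₂ meet V≐ E≐ w₁ (inj₁ to-s) =
    inj₁ (Reach-map (∖-mono (≐∪-inj₁ V≐)) (≐∪₂-inj₁ E≐) to-s)
  series-avoid {x = x} D₁ D₂ meet V≐ E≐ w₁ (inj₂ to-m) with SP-dec-V D₂ x
  ... | no x∉V₂ = inj₂ (Reach-trans (Reach-map (∖-mono (≐∪-inj₁ V≐)) (≐∪₂-inj₁ E≐) to-m)
                                    (Reach-map (λ z → ∖-mono (≐∪-inj₂ V≐) z ∘ ⊆∖ x∉V₂ z) (≐∪₂-inj₂ E≐)
                                               (SP-reaches-target D₂ (SP-source D₂))))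
  ... | yes x∈V₂ = inj₁ (Reach-map (λ z → ∖-mono (≐∪-inj₁ V≐) z ∘ ⊆∖ x∉V₁ z) (≐∪₂-inj₁ E≐) (SP-reaches-source D₁ w₁))
    where x∉V₁ = λ x∈V₁ → proj₂ (proj₂ (Reach-endpoints to-m)) (sym (meet x x∈V₁ x∈V₂))

SP-avoid : SP V E s t → (V ∖ x) w → Reach E (V ∖ x) w s ⊎ Reach E (V ∖ x) w t
SP-avoid (edge _ V≐ _) w∈ with ≐-to V≐ (proj₁ w∈)
... | inj₁ refl = inj₁ (here w∈)
... | inj₂ refl = inj₂ (here w∈)
SP-avoid (series D₁ D₂ meet V≐ E≐) (Vw , w≢x) with ≐-to V≐ Vw
... | inj₁ w₁ = series-avoid D₁ D₂ meet V≐ E≐ w₁ (SP-avoid D₁ (w₁ , w≢x))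
... | inj₂ w₂ = swap (series-avoid (SP-reverse D₂) (SP-reverse D₁) (λ z z₂ z₁ → meet z z₁ z₂)
                                   (≐-trans V≐ ∪-comm) (≐₂-trans E≐ ∪₂-comm) w₂ (swap (SP-avoid D₂ (w₂ , w≢x))))
SP-avoid (parallel D₁ D₂ _ V≐ E≐) (Vw , w≢x) with ≐-to V≐ Vw
... | inj₁ w₁ = ⊎-map (Reach-map (∖-mono (≐∪-inj₁ V≐)) (≐∪₂-inj₁ E≐))
                      (Reach-map (∖-mono (≐∪-inj₁ V≐)) (≐∪₂-inj₁ E≐)) (SP-avoid D₁ (w₁ , w≢x))
... | inj₂ w₂ = ⊎-map (Reach-map (∖-mono (≐∪-inj₂ V≐)) (≐∪₂-inj₂ E≐))
                      (Reach-map (∖-mono (≐∪-inj₂ V≐)) (≐∪₂-inj₂ E≐)) (SP-avoid D₂ (w₂ , w≢x))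

∪-reassoc : V ≐ (V₁ ∪ V₂) → (V ∪ X) ≐ (V₁ ∪ (V₂ ∪ X))
∪-reassoc V≐ _ = [ [ inj₁ , inj₂ ∘ inj₁ ] ∘ ≐-to V≐ , inj₂ ∘ inj₂ ]
               , [ inj₁ ∘ ≐-from V≐ ∘ inj₁ , [ inj₁ ∘ ≐-from V≐ ∘ inj₂ , inj₂ ] ]

∪₂-reassoc : {G : EPred n} → E ≐₂ (E₁ ∪₂ E₂) → (E ∪₂ G) ≐₂ (E₁ ∪₂ (E₂ ∪₂ G))
∪₂-reassoc E≐ _ _ = [ [ inj₁ , inj₂ ∘ inj₁ ] ∘ ≐₂-to E≐ , inj₂ ∘ inj₂ ]
                  , [ inj₁ ∘ ≐₂-from E≐ ∘ inj₁ , [ inj₁ ∘ ≐₂-from E≐ ∘ inj₂ , inj₂ ] ]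

-- By induction on the first graph: the part not containing the edge is absorbed into the closing graph P.
SP-reroot : SP V E u v → E x y → SP X F u v → (∀ z → V z → X z → Pair u v z) →
            SP (V ∪ X) (E ∪₂ F) x y
SP-reroot D@(edge _ _ E≐) e P meetP with ≐₂-to E≐ e
... | inj₁ (refl , refl) = parallel D P meetP ≐-refl ≐₂-refl
... | inj₂ (refl , refl) = SP-reverse (parallel D P meetP ≐-refl ≐₂-refl)
SP-reroot {X = X} (series {V₁ = V₁} {V₂ = V₂} {s = u} {m = m} {t = v} D₁ D₂ meet V≐ E≐) e P meetP with ≐₂-to E≐ e
... | inj₁ e₁ = SP-resp (≐-sym (∪-reassoc V≐)) (≐₂-sym (∪₂-reassoc E≐))
                  (SP-reroot D₁ e₁ (series P (SP-reverse D₂) P-meets-D₂ ∪-comm ∪₂-comm) meets)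
  where
  P-meets-D₂ : ∀ z → X z → V₂ z → z ≡ v
  P-meets-D₂ z Xz z₂ with meetP z (≐∪-inj₂ V≐ z z₂) Xz
  ... | inj₂ z≡v  = z≡v
  ... | inj₁ refl = ⊥-elim (SP-terminals-distinct D₁ (meet z (SP-source D₁) z₂))
  meets : ∀ z → V₁ z → (V₂ ∪ X) z → Pair u m z
  meets z z₁ (inj₁ z₂) = inj₂ (meet z z₁ z₂)
  meets z z₁ (inj₂ Xz) with meetP z (≐∪-inj₁ V≐ z z₁) Xz
  ... | inj₁ z≡u  = inj₁ z≡u
  ... | inj₂ refl = inj₂ (meet z z₁ (SP-target D₂))
... | inj₂ e₂ = SP-resp (≐-sym (∪-reassoc (≐-trans V≐ ∪-comm))) (≐₂-sym (∪₂-reassoc (≐₂-trans E≐ ∪₂-comm)))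
                  (SP-reroot D₂ e₂ (series (SP-reverse D₁) P D₁-meets-P ≐-refl ≐₂-refl) meets)
  where
  D₁-meets-P : ∀ z → V₁ z → X z → z ≡ u
  D₁-meets-P z z₁ Xz with meetP z (≐∪-inj₁ V≐ z z₁) Xz
  ... | inj₁ z≡u  = z≡u
  ... | inj₂ refl = ⊥-elim (SP-terminals-distinct D₂ (sym (meet z z₁ (SP-target D₂))))
  meets : ∀ z → V₂ z → (V₁ ∪ X) z → Pair m v z
  meets z z₂ (inj₁ z₁) = inj₁ (meet z z₁ z₂)
  meets z z₂ (inj₂ Xz) with meetP z (≐∪-inj₂ V≐ z z₂) Xz
  ... | inj₂ z≡v  = inj₂ z≡v
  ... | inj₁ refl = inj₁ (meet z (SP-source D₁) z₂)
SP-reroot (parallel D₁ D₂ meet V≐ E≐) e P meetP with ≐₂-to E≐ e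
... | inj₁ e₁ = SP-resp (≐-sym (∪-reassoc V≐)) (≐₂-sym (∪₂-reassoc E≐))
                  (SP-reroot D₁ e₁ (parallel D₂ P (λ z → meetP z ∘ ≐∪-inj₂ V≐ z) ≐-refl ≐₂-refl)
                             (λ z z₁ → [ meet z z₁ , meetP z (≐∪-inj₁ V≐ z z₁) ]))
... | inj₂ e₂ = SP-resp (≐-sym (∪-reassoc (≐-trans V≐ ∪-comm))) (≐₂-sym (∪₂-reassoc (≐₂-trans E≐ ∪₂-comm)))
                  (SP-reroot D₂ e₂ (parallel D₁ P (λ z → meetP z ∘ ≐∪-inj₁ V≐ z) ≐-refl ≐₂-refl)
                             (λ z z₂ → [ (λ z₁ → meet z z₁ z₂) , meetP z (≐∪-inj₂ V≐ z z₂) ]))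

SP-induced : {X′ : VPred n} → SP X′ F s t → X ≐ X′ →
             (∀ {x y} → X′ x → X′ y → E x y → F x y) → F ⊆₂ E → SP X (Induced E X) s t
SP-induced {F = F} {X = X} {E = E} D X≐ E⊆F F⊆E = SP-resp (≐-sym X≐) (≐₂-sym Induced≐F) D
  where
  Induced≐F : Induced E X ≐₂ F
  Induced≐F x y = (λ (Xx , Xy , e) → E⊆F (≐-to X≐ Xx) (≐-to X≐ Xy) e)
                , (λ f → let X′x , X′y = SP-edge-ends D f in ≐-from X≐ X′x , ≐-from X≐ X′y , F⊆E x y f)

SP-induced-self : SP V E s t → SP V (Induced E V) s t
SP-induced-self D = SP-induced D ≐-refl (λ _ _ e → e) ⊆₂-refl

Induced-≐ : V ≐ W → Induced E V ≐₂ Induced E W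
Induced-≐ V≐W x y = (λ (Vx , Vy , e) → ≐-to V≐W Vx , ≐-to V≐W Vy , e)
                  , (λ (Wx , Wy , e) → ≐-from V≐W Wx , ≐-from V≐W Wy , e)

-- Bridges of a vertex cut S, as in Tutte: a component of V − S together with S itself; Bridge₁ is the
-- bridge of {s} containing v, Bridge₂ the bridge of {s, t} containing h.
Bridge₁ : VPred n → EPred n → Fin n → Fin n → VPred n
Bridge₁ V E s v z = z ≡ s ⊎ Reach E (V ∖ s) v z

Bridge₁-⊆ : V s → Bridge₁ V E s v ⊆′ V
Bridge₁-⊆ Vs _ (inj₁ refl) = Vs
Bridge₁-⊆ Vs _ (inj₂ r)    = proj₁ (proj₂ (Reach-endpoints r))

Bridge₁-whole : SP V E u v → Bridge₁ V E u v ≐ V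
Bridge₁-whole {V = V} {E = E} {u = u} {v = v} D z = Bridge₁-⊆ (SP-source D) z , into
  where
  into : V z → Bridge₁ V E u v z
  into Vz with z ≟ u
  ... | yes z≡u = inj₁ z≡u
  ... | no z≢u with SP-avoid D (Vz , z≢u)
  ...   | inj₁ r = ⊥-elim (¬Reach-removed r)
  ...   | inj₂ r = inj₂ (Reach-sym (λ _ _ → SP-sym D) r)

Bridges₁AreSP : VPred n → EPred n → Fin n → Fin n → Set₁
Bridges₁AreSP V E u v = ∀ {s} → V s → s ≢ v → ¬ Reach E (V ∖ s) v u →
                        SP (Bridge₁ V E s v) (Induced E (Bridge₁ V E s v)) s v

module Series {n : ℕ} {V V₁ V₂ : VPred n} {E E₁ E₂ : EPred n} {u m v : Fin n}
  (D₁ : SP V₁ E₁ u m) (D₂ : SP V₂ E₂ m v) (meet : ∀ z → V₁ z → V₂ z → z ≡ m)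
  (V≐ : V ≐ (V₁ ∪ V₂)) (E≐ : E ≐₂ (E₁ ∪₂ E₂)) where

  whole : SP V E u v
  whole = series D₁ D₂ meet V≐ E≐

  lift₁ : W ⊆′ X → Reach E₁ W x y → Reach E X x y
  lift₁ f = Reach-map f (≐∪₂-inj₁ E≐)

  lift₂ : W ⊆′ X → Reach E₂ W x y → Reach E X x y
  lift₂ f = Reach-map f (≐∪₂-inj₂ E≐)

  no-E₁-edge-in-V₂ : V₂ x → V₂ y → ¬ E₁ x y
  no-E₁-edge-in-V₂ {x = x} {y = y} x₂ y₂ e₁ =
    SP-irrefl D₁ (subst₂ E₁ (meet x (proj₁ (SP-edge-ends D₁ e₁)) x₂) (meet y (proj₂ (SP-edge-ends D₁ e₁)) y₂) e₁)

  no-E₂-edge-in-V₁ : V₁ x → V₁ y → ¬ E₂ x y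
  no-E₂-edge-in-V₁ {x = x} {y = y} x₁ y₁ e₂ =
    SP-irrefl D₂ (subst₂ E₂ (meet x x₁ (proj₁ (SP-edge-ends D₂ e₂))) (meet y y₁ (proj₂ (SP-edge-ends D₂ e₂))) e₂)

  split-edges : {X Y : VPred n} → X ⊆′ V₁ → Y ⊆′ V₂ → X m → Y m →
                (X ∪ Y) x → (X ∪ Y) y → E x y → (Induced E₁ X ∪₂ Induced E₂ Y) x y
  split-edges {X = X} {Y = Y} X⊆V₁ Y⊆V₂ Xm Ym x∈ y∈ e with ≐₂-to E≐ e
  ... | inj₁ e₁ = inj₁ (to-X x∈ (proj₁ (SP-edge-ends D₁ e₁)) , to-X y∈ (proj₂ (SP-edge-ends D₁ e₁)) , e₁)
    where
    to-X : ∀ {z} → (X ∪ Y) z → V₁ z → X z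
    to-X (inj₁ Xz) _       = Xz
    to-X {z} (inj₂ Yz) z₁ = subst X (sym (meet z z₁ (Y⊆V₂ z Yz))) Xm
  ... | inj₂ e₂ = inj₂ (to-Y x∈ (proj₁ (SP-edge-ends D₂ e₂)) , to-Y y∈ (proj₂ (SP-edge-ends D₂ e₂)) , e₂)
    where
    to-Y : ∀ {z} → (X ∪ Y) z → V₂ z → Y z
    to-Y (inj₂ Yz) _       = Yz
    to-Y {z} (inj₁ Xz) z₂ = subst Y (sym (meet z (X⊆V₁ z Xz) z₂)) Ym

  split-edges-⊆ : {X Y : VPred n} → (Induced E₁ X ∪₂ Induced E₂ Y) ⊆₂ E
  split-edges-⊆ x y = [ ≐∪₂-inj₁ E≐ x y ∘ proj₂ ∘ proj₂ , ≐∪₂-inj₂ E≐ x y ∘ proj₂ ∘ proj₂ ]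

  bridge₁-within-V₂ : Bridges₁AreSP V₂ E₂ m v → V₂ s → s ≢ v → ¬ Reach E (V ∖ s) v u →
                      SP (Bridge₁ V E s v) (Induced E (Bridge₁ V E s v)) s v
  bridge₁-within-V₂ {s = s} bridges₂ s₂ s≢v cut =
    SP-induced (bridges₂ s₂ s≢v cut₂) Bridge≐ inside (λ x y → ≐∪₂-inj₂ E≐ x y ∘ proj₂ ∘ proj₂)
    where
    cut₂ : ¬ Reach E₂ (V₂ ∖ s) v m
    cut₂ r = cut (Reach-trans (lift₂ (∖-mono (≐∪-inj₂ V≐)) r)
                              (lift₁ (λ z → ∖-mono (≐∪-inj₁ V≐) z ∘ ⊆∖ s∉V₁ z) (SP-reaches-source D₁ (SP-target D₁))))
      where s∉V₁ = λ s₁ → proj₂ (proj₂ (Reach-endpoints r)) (sym (meet s s₁ s₂))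
    stays-in-V₂ : Reach E₂ (V₂ ∖ s) v x → E x y → (V ∖ s) y → Reach E₂ (V₂ ∖ s) v y
    stays-in-V₂ {x = x} r e (_ , y≢s) with ≐₂-to E≐ e
    ... | inj₂ e₂ = step r e₂ (proj₂ (SP-edge-ends D₂ e₂) , y≢s)
    ... | inj₁ e₁ = ⊥-elim (cut₂ (subst (Reach E₂ (V₂ ∖ s) v)
                                        (meet x (proj₁ (SP-edge-ends D₁ e₁)) (proj₁ (proj₂ (Reach-endpoints r)))) r))
    Bridge≐ : Bridge₁ V E s v ≐ Bridge₁ V₂ E₂ s v
    Bridge≐ z = [ inj₁ , inj₂ ∘ Reach-closed _ (here (SP-target D₂ , s≢v ∘ sym)) stays-in-V₂ ]
              , [ inj₁ , inj₂ ∘ lift₂ (∖-mono (≐∪-inj₂ V≐)) ]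
    inside : Bridge₁ V₂ E₂ s v x → Bridge₁ V₂ E₂ s v y → E x y → Induced E₂ (Bridge₁ V₂ E₂ s v) x y
    inside {x = x} {y = y} x∈ y∈ e =
      x∈ , y∈ , [ ⊥-elim ∘ no-E₁-edge-in-V₂ (Bridge₁-⊆ s₂ x x∈) (Bridge₁-⊆ s₂ y y∈) , id ]′ (≐₂-to E≐ e)

  bridge₁-within-V₁ : Bridges₁AreSP V₁ E₁ u m → V₁ s → ¬ V₂ s → ¬ Reach E (V ∖ s) v u →
                      SP (Bridge₁ V E s v) (Induced E (Bridge₁ V E s v)) s v
  bridge₁-within-V₁ {s = s} bridges₁ s₁ s∉V₂ cut =
    SP-induced (series A (SP-induced-self D₂) (λ z → meet z ∘ Bridge₁-⊆ s₁ z) ≐-refl ≐₂-refl) Bridge≐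
               (split-edges (Bridge₁-⊆ s₁) (λ _ → id) (inj₂ (here m∈V₁∖s)) (SP-source D₂)) split-edges-⊆
    where
    m∈V₁∖s : (V₁ ∖ s) m
    m∈V₁∖s = SP-target D₁ , λ { refl → s∉V₂ (SP-source D₂) }
    from-V₂ : Reach E₂ V₂ x y → Reach E (V ∖ s) x y
    from-V₂ = lift₂ (λ z → ∖-mono (≐∪-inj₂ V≐) z ∘ ⊆∖ s∉V₂ z)
    v⇝m : Reach E (V ∖ s) v m
    v⇝m = from-V₂ (SP-connected D₂ (SP-target D₂) (SP-source D₂))
    A : SP (Bridge₁ V₁ E₁ s m) (Induced E₁ (Bridge₁ V₁ E₁ s m)) s m
    A = bridges₁ s₁ (proj₂ m∈V₁∖s ∘ sym) (cut ∘ Reach-trans v⇝m ∘ lift₁ (∖-mono (≐∪-inj₁ V≐)))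
    Side : VPred n
    Side y = Reach E₁ (V₁ ∖ s) m y ⊎ V₂ y
    step-Side : Side x → E x y → (V ∖ s) y → Side y
    step-Side {x = x} {y = y} x∈ e (_ , y≢s) with ≐₂-to E≐ e | x∈
    ... | inj₂ e₂ | _       = inj₂ (proj₂ (SP-edge-ends D₂ e₂))
    ... | inj₁ e₁ | inj₁ r  = inj₁ (step r e₁ (proj₂ (SP-edge-ends D₁ e₁) , y≢s))
    ... | inj₁ e₁ | inj₂ x₂ = inj₁ (step (here m∈V₁∖s)
                                         (subst (λ z → E₁ z y) (meet x (proj₁ (SP-edge-ends D₁ e₁)) x₂) e₁)
                                         (proj₂ (SP-edge-ends D₁ e₁) , y≢s))
    Bridge≐ : Bridge₁ V E s v ≐ (Bridge₁ V₁ E₁ s m ∪ V₂)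
    Bridge≐ z = [ inj₁ ∘ inj₁ , [ inj₁ ∘ inj₂ , inj₂ ] ∘ Reach-closed Side (inj₂ (SP-target D₂)) step-Side ]
              , [ [ inj₁ , inj₂ ∘ Reach-trans v⇝m ∘ lift₁ (∖-mono (≐∪-inj₁ V≐)) ]
                , inj₂ ∘ from-V₂ ∘ SP-connected D₂ (SP-target D₂) ]

SP-bridge₁ : SP V E u v → Bridges₁AreSP V E u v
SP-bridge₁ D@(edge _ V≐ _) Vs s≢v cut with ≐-to V≐ Vs
... | inj₁ refl = SP-induced D (Bridge₁-whole D) (λ _ _ e → e) ⊆₂-refl
... | inj₂ refl = ⊥-elim (s≢v refl)
SP-bridge₁ {u = u} D@(parallel D₁ D₂ meet V≐ E≐) {s} Vs s≢v cut with s ≟ u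
... | yes refl = SP-induced D (Bridge₁-whole D) (λ _ _ e → e) ⊆₂-refl
... | no s≢u with ≐-to V≐ Vs
...   | inj₁ s₁ = ⊥-elim (cut (Reach-map (λ z → ∖-mono (≐∪-inj₂ V≐) z ∘ ⊆∖ (λ s₂ → [ s≢u , s≢v ] (meet s s₁ s₂)) z)
                                          (≐∪₂-inj₂ E≐) (SP-reaches-source D₂ (SP-target D₂))))
...   | inj₂ s₂ = ⊥-elim (cut (Reach-map (λ z → ∖-mono (≐∪-inj₁ V≐) z ∘ ⊆∖ (λ s₁ → [ s≢u , s≢v ] (meet s s₁ s₂)) z)
                                          (≐∪₂-inj₁ E≐) (SP-reaches-source D₁ (SP-target D₁))))
SP-bridge₁ (series D₁ D₂ meet V≐ E≐) {s} Vs s≢v cut with SP-dec-V D₂ s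
... | yes s₂  = Series.bridge₁-within-V₂ D₁ D₂ meet V≐ E≐ (SP-bridge₁ D₂) s₂ s≢v cut
... | no s∉V₂ = Series.bridge₁-within-V₁ D₁ D₂ meet V≐ E≐ (SP-bridge₁ D₁)
                  ([ id , ⊥-elim ∘ s∉V₂ ]′ (≐-to V≐ Vs)) s∉V₂ cut

Minus2-dec : Decidable (Minus2 s t)
Minus2-dec {s = s} {t = t} y = ¬? (y ≟ s) ×-dec ¬? (y ≟ t)

Minus2-or-Pair : ∀ y → Minus2 s t y ⊎ Pair s t y
Minus2-or-Pair {s = s} {t = t} y with y ≟ s | y ≟ t
... | yes y≡s | _       = inj₂ (inj₁ y≡s)
... | no _    | yes y≡t = inj₂ (inj₂ y≡t)
... | no y≢s  | no y≢t  = inj₁ (y≢s , y≢t)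

Bridge₂ : VPred n → EPred n → Fin n → Fin n → Fin n → VPred n
Bridge₂ V E s t h = Reach E (V ∩ Minus2 s t) h ∪ Pair s t

Bridges₂AreSP : VPred n → EPred n → Fin n → Fin n → Set₁
Bridges₂AreSP V E u v = ∀ {s t h} → s ≢ t → V s → V t → (V ∩ Minus2 s t) h →
  ¬ Reach E (V ∩ Minus2 s t) h u → ¬ Reach E (V ∩ Minus2 s t) h v →
  SP (Bridge₂ V E s t h) (Induced E (Bridge₂ V E s t h)) s t

Bridges₂AreSP-swap : Bridges₂AreSP V E u v → Bridges₂AreSP V E v u
Bridges₂AreSP-swap bridges s≢t Vs Vt h∈ ¬h⇝v ¬h⇝u = bridges s≢t Vs Vt h∈ ¬h⇝u ¬h⇝v

Minus2-swap : (V ∩ Minus2 s t) ⊆′ (V ∩ Minus2 t s)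
Minus2-swap _ (Vz , z≢s , z≢t) = Vz , z≢t , z≢s

Bridge₂-swap : Bridge₂ V E t s h ≐ Bridge₂ V E s t h
Bridge₂-swap z = [ inj₁ ∘ Reach-map Minus2-swap ⊆₂-refl , inj₂ ∘ swap ]
               , [ inj₁ ∘ Reach-map Minus2-swap ⊆₂-refl , inj₂ ∘ swap ]

SP-separator-inside : SP V E u v → (V ∩ Minus2 s t) h →
                      ¬ Reach E (V ∩ Minus2 s t) h u → ¬ Reach E (V ∩ Minus2 s t) h v → V s × V t
SP-separator-inside {V = V} {s = s} {t = t} {h = h} D (Vh , h≢s , h≢t) ¬h⇝u ¬h⇝v =
  member s t (Vh , h≢t) (λ ¬Vs z (Vz , z≢t) → Vz , (λ { refl → ¬Vs Vz }) , z≢t) ,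
  member t s (Vh , h≢s) (λ ¬Vt z (Vz , z≢s) → Vz , z≢s , λ { refl → ¬Vt Vz })
  where
  member : ∀ x y → (V ∖ y) h → (¬ V x → (V ∖ y) ⊆′ (V ∩ Minus2 s t)) → V x
  member x y h∈ avoids-x with SP-dec-V D x
  ... | yes Vx = Vx
  ... | no ¬Vx = ⊥-elim ([ ¬h⇝u ∘ Reach-map (avoids-x ¬Vx) ⊆₂-refl
                         , ¬h⇝v ∘ Reach-map (avoids-x ¬Vx) ⊆₂-refl ] (SP-avoid D h∈))

Bridge₂-⊆ : V s → V t → Bridge₂ V E s t h ⊆′ V
Bridge₂-⊆ _ _ _ (inj₁ r)           = proj₁ (proj₂ (Reach-endpoints r))
Bridge₂-⊆ Vs _ _ (inj₂ (inj₁ refl)) = Vs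
Bridge₂-⊆ _ Vt _ (inj₂ (inj₂ refl)) = Vt

Bridge₂-confined : {a b c d : Fin n} → V ≐ (V₁ ∪ V₂) → E ≐₂ (E₁ ∪₂ E₂) → SP V₁ E₁ a b → SP V₂ E₂ c d →
                   (V₁ ∩ Minus2 s t) h →
                   (∀ {y} → Reach E₁ (V₁ ∩ Minus2 s t) h y → ¬ V₂ y) →
                   Bridge₂ V E s t h ≐ Bridge₂ V₁ E₁ s t h
Bridge₂-confined {V = V} {V₁ = V₁} {E = E} {E₁ = E₁} {s = s} {t = t} {h = h} V≐ E≐ D₁ D₂ h∈ avoids-V₂ z =
  [ inj₁ ∘ Reach-closed _ (here h∈) stays-in-V₁ , inj₂ ]
  , [ inj₁ ∘ Reach-map (λ z (z₁ , z∉) → ≐∪-inj₁ V≐ z z₁ , z∉) (≐∪₂-inj₁ E≐) , inj₂ ]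
  where
  stays-in-V₁ : Reach E₁ (V₁ ∩ Minus2 s t) h x → E x y → (V ∩ Minus2 s t) y → Reach E₁ (V₁ ∩ Minus2 s t) h y
  stays-in-V₁ r e (_ , y∉) with ≐₂-to E≐ e
  ... | inj₁ e₁ = step r e₁ (proj₂ (SP-edge-ends D₁ e₁) , y∉)
  ... | inj₂ e₂ = ⊥-elim (avoids-V₂ r (proj₁ (SP-edge-ends D₂ e₂)))

module SeriesBridge₂ {n : ℕ} {V V₁ V₂ : VPred n} {E E₁ E₂ : EPred n} {u m v : Fin n}
  (D₁ : SP V₁ E₁ u m) (D₂ : SP V₂ E₂ m v) (meet : ∀ z → V₁ z → V₂ z → z ≡ m)
  (V≐ : V ≐ (V₁ ∪ V₂)) (E≐ : E ≐₂ (E₁ ∪₂ E₂)) where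

  open Series D₁ D₂ meet V≐ E≐

  -- s and t lie on opposite sides of m, which the component of h reaches: the bridge is the side of m
  -- cut off by s in the first part, followed by the side of m cut off by t in the second.
  module Across {s t h : Fin n} (s₁ : V₁ s) (s∉V₂ : ¬ V₂ s) (t₂ : V₂ t) (t∉V₁ : ¬ V₁ t)
                (h⇝m : Reach E (V ∩ Minus2 s t) h m)
                (¬h⇝u : ¬ Reach E (V ∩ Minus2 s t) h u) (¬h⇝v : ¬ Reach E (V ∩ Minus2 s t) h v) where

    m∈V₁∖s : (V₁ ∖ s) m
    m∈V₁∖s = SP-target D₁ , λ { refl → s∉V₂ (SP-source D₂) }

    m∈V₂∖t : (V₂ ∖ t) m
    m∈V₂∖t = SP-source D₂ , λ { refl → t∉V₁ (SP-target D₁) }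

    lift-V₁∖s : Reach E₁ (V₁ ∖ s) x y → Reach E (V ∩ Minus2 s t) x y
    lift-V₁∖s = lift₁ (λ z (z₁ , z≢s) → ≐∪-inj₁ V≐ z z₁ , z≢s , λ { refl → t∉V₁ z₁ })

    lift-V₂∖t : Reach E₂ (V₂ ∖ t) x y → Reach E (V ∩ Minus2 s t) x y
    lift-V₂∖t = lift₂ (λ z (z₂ , z≢t) → ≐∪-inj₂ V≐ z z₂ , (λ { refl → s∉V₂ z₂ }) , z≢t)

    A : SP (Bridge₁ V₁ E₁ s m) (Induced E₁ (Bridge₁ V₁ E₁ s m)) s m
    A = SP-bridge₁ D₁ s₁ (proj₂ m∈V₁∖s ∘ sym) (¬h⇝u ∘ Reach-trans h⇝m ∘ lift-V₁∖s)

    B : SP (Bridge₁ V₂ E₂ t m) (Induced E₂ (Bridge₁ V₂ E₂ t m)) m t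
    B = SP-reverse (SP-bridge₁ (SP-reverse D₂) t₂ (proj₂ m∈V₂∖t ∘ sym) (¬h⇝v ∘ Reach-trans h⇝m ∘ lift-V₂∖t))

    FromM : VPred n
    FromM y = Reach E₁ (V₁ ∖ s) m y ⊎ Reach E₂ (V₂ ∖ t) m y

    step-FromM : FromM x → E x y → (V ∩ Minus2 s t) y → FromM y
    step-FromM {x = x} {y = y} x∈ e (_ , y≢s , y≢t) with ≐₂-to E≐ e | x∈
    ... | inj₁ e₁ | inj₁ r₁ = inj₁ (step r₁ e₁ (proj₂ (SP-edge-ends D₁ e₁) , y≢s))
    ... | inj₁ e₁ | inj₂ r₂ = inj₁ (step (here m∈V₁∖s)
      (subst (λ z → E₁ z y) (meet x (proj₁ (SP-edge-ends D₁ e₁)) (proj₁ (proj₂ (Reach-endpoints r₂)))) e₁)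
      (proj₂ (SP-edge-ends D₁ e₁) , y≢s))
    ... | inj₂ e₂ | inj₂ r₂ = inj₂ (step r₂ e₂ (proj₂ (SP-edge-ends D₂ e₂) , y≢t))
    ... | inj₂ e₂ | inj₁ r₁ = inj₂ (step (here m∈V₂∖t)
      (subst (λ z → E₂ z y) (meet x (proj₁ (proj₂ (Reach-endpoints r₁))) (proj₁ (SP-edge-ends D₂ e₂))) e₂)
      (proj₂ (SP-edge-ends D₂ e₂) , y≢t))

    Bridge≐ : Bridge₂ V E s t h ≐ (Bridge₁ V₁ E₁ s m ∪ Bridge₁ V₂ E₂ t m)
    Bridge≐ z = [ [ inj₁ ∘ inj₂ , inj₂ ∘ inj₂ ]
                  ∘ Reach-closed FromM (inj₁ (here m∈V₁∖s)) step-FromM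
                  ∘ Reach-trans (Reach-sym (λ _ _ → SP-sym whole) h⇝m)
                , [ inj₁ ∘ inj₁ , inj₂ ∘ inj₁ ] ]
              , [ [ inj₂ ∘ inj₁ , inj₁ ∘ Reach-trans h⇝m ∘ lift-V₁∖s ]
                , [ inj₂ ∘ inj₂ , inj₁ ∘ Reach-trans h⇝m ∘ lift-V₂∖t ] ]

    bridge : SP (Bridge₂ V E s t h) (Induced E (Bridge₂ V E s t h)) s t
    bridge = SP-induced (series A B (λ z z∈A → meet z (Bridge₁-⊆ s₁ z z∈A) ∘ Bridge₁-⊆ t₂ z) ≐-refl ≐₂-refl) Bridge≐
               (split-edges (Bridge₁-⊆ s₁) (Bridge₁-⊆ t₂) (inj₂ (here m∈V₁∖s)) (inj₂ (here m∈V₂∖t))) split-edges-⊆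

  bridge-through-m : V s → V t → Reach E (V ∩ Minus2 s t) h m →
                     ¬ Reach E (V ∩ Minus2 s t) h u → ¬ Reach E (V ∩ Minus2 s t) h v →
                     SP (Bridge₂ V E s t h) (Induced E (Bridge₂ V E s t h)) s t
  bridge-through-m {s = s} {t = t} {h = h} Vs Vt h⇝m ¬h⇝u ¬h⇝v = by-sides (SP-dec-V D₁ s) (SP-dec-V D₁ t)
    where
    s≢m : s ≢ m
    s≢m s≡m = proj₁ (proj₂ (proj₂ (Reach-endpoints h⇝m))) (sym s≡m)
    t≢m : t ≢ m
    t≢m t≡m = proj₂ (proj₂ (proj₂ (Reach-endpoints h⇝m))) (sym t≡m)
    by-sides : Dec (V₁ s) → Dec (V₁ t) → SP (Bridge₂ V E s t h) (Induced E (Bridge₂ V E s t h)) s t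
    by-sides (yes s₁) (yes t₁) =
      ⊥-elim (¬h⇝v (Reach-trans h⇝m (lift₂ into (SP-connected D₂ (SP-source D₂) (SP-target D₂)))))
      where
      into : V₂ ⊆′ (V ∩ Minus2 s t)
      into z z₂ = ≐∪-inj₂ V≐ z z₂ , (λ { refl → s≢m (meet z s₁ z₂) }) , (λ { refl → t≢m (meet z t₁ z₂) })
    by-sides (no s∉V₁) (no t∉V₁) =
      ⊥-elim (¬h⇝u (Reach-trans h⇝m (lift₁ into (SP-connected D₁ (SP-target D₁) (SP-source D₁)))))
      where
      into : V₁ ⊆′ (V ∩ Minus2 s t)
      into z z₁ = ≐∪-inj₁ V≐ z z₁ , (λ { refl → s∉V₁ z₁ }) , (λ { refl → t∉V₁ z₁ })
    by-sides (yes s₁) (no t∉V₁) =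
      Across.bridge s₁ (s≢m ∘ meet s s₁) ([ ⊥-elim ∘ t∉V₁ , id ]′ (≐-to V≐ Vt)) t∉V₁ h⇝m ¬h⇝u ¬h⇝v
    by-sides (no s∉V₁) (yes t₁) =
      SP-resp Bridge₂-swap (Induced-≐ Bridge₂-swap)
        (SP-reverse (Across.bridge t₁ (t≢m ∘ meet t t₁) ([ ⊥-elim ∘ s∉V₁ , id ]′ (≐-to V≐ Vs)) s∉V₁
                                   (Reach-map Minus2-swap ⊆₂-refl h⇝m)
                                   (¬h⇝u ∘ Reach-map Minus2-swap ⊆₂-refl)
                                   (¬h⇝v ∘ Reach-map Minus2-swap ⊆₂-refl)))

  bridge-within-V₁ : Bridges₂AreSP V₁ E₁ u m → s ≢ t → (V₁ ∩ Minus2 s t) h →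
                     ¬ Reach E (V ∩ Minus2 s t) h u → ¬ Reach E (V ∩ Minus2 s t) h m →
                     SP (Bridge₂ V E s t h) (Induced E (Bridge₂ V E s t h)) s t
  bridge-within-V₁ {s = s} {t = t} {h = h} bridges₁ s≢t h∈ ¬h⇝u ¬h⇝m =
    SP-induced (bridges₁ s≢t s₁ t₁ h∈ (¬h⇝u ∘ lift) (¬h⇝m ∘ lift)) Bridge≐ inside
               (λ x y → ≐∪₂-inj₁ E≐ x y ∘ proj₂ ∘ proj₂)
    where
    lift : Reach E₁ (V₁ ∩ Minus2 s t) x y → Reach E (V ∩ Minus2 s t) x y
    lift = lift₁ (λ z (z₁ , z∉) → ≐∪-inj₁ V≐ z z₁ , z∉)
    s₁ : V₁ s
    s₁ = proj₁ (SP-separator-inside D₁ h∈ (¬h⇝u ∘ lift) (¬h⇝m ∘ lift))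
    t₁ : V₁ t
    t₁ = proj₂ (SP-separator-inside D₁ h∈ (¬h⇝u ∘ lift) (¬h⇝m ∘ lift))
    Bridge≐ : Bridge₂ V E s t h ≐ Bridge₂ V₁ E₁ s t h
    Bridge≐ = Bridge₂-confined V≐ E≐ D₁ D₂ h∈ λ {y} r y₂ →
      ¬h⇝m (lift (subst (Reach E₁ (V₁ ∩ Minus2 s t) h) (meet y (proj₁ (proj₂ (Reach-endpoints r))) y₂) r))
    inside : Bridge₂ V₁ E₁ s t h x → Bridge₂ V₁ E₁ s t h y → E x y → Induced E₁ (Bridge₂ V₁ E₁ s t h) x y
    inside {x = x} {y = y} x∈ y∈ e =
      x∈ , y∈ , [ id , ⊥-elim ∘ no-E₂-edge-in-V₁ (Bridge₂-⊆ s₁ t₁ x x∈) (Bridge₂-⊆ s₁ t₁ y y∈) ]′ (≐₂-to E≐ e)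

  bridge-from-V₁ : Bridges₂AreSP V₁ E₁ u m → s ≢ t → V s → V t → (V₁ ∩ Minus2 s t) h →
                   ¬ Reach E (V ∩ Minus2 s t) h u → ¬ Reach E (V ∩ Minus2 s t) h v →
                   SP (Bridge₂ V E s t h) (Induced E (Bridge₂ V E s t h)) s t
  bridge-from-V₁ {s = s} {t = t} {h = h} bridges₁ s≢t Vs Vt h∈ ¬h⇝u ¬h⇝v
    with Reach-dec (SP-dec-E whole) (λ x → SP-dec-V whole x ×-dec Minus2-dec x) h m
  ... | yes h⇝m = bridge-through-m Vs Vt h⇝m ¬h⇝u ¬h⇝v
  ... | no ¬h⇝m = bridge-within-V₁ bridges₁ s≢t h∈ ¬h⇝u ¬h⇝m

module ParallelBridge₂ {n : ℕ} {V V₁ V₂ : VPred n} {E E₁ E₂ : EPred n} {u v : Fin n}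
  (D₁ : SP V₁ E₁ u v) (D₂ : SP V₂ E₂ u v) (meet : ∀ z → V₁ z → V₂ z → Pair u v z)
  (V≐ : V ≐ (V₁ ∪ V₂)) (E≐ : E ≐₂ (E₁ ∪₂ E₂)) (bridges₁ : Bridges₂AreSP V₁ E₁ u v)
  {s t h : Fin n} (s≢t : s ≢ t) (h∈ : (V₁ ∩ Minus2 s t) h)
  (¬h⇝u : ¬ Reach E (V ∩ Minus2 s t) h u) (¬h⇝v : ¬ Reach E (V ∩ Minus2 s t) h v) where

  private
    lift : Reach E₁ (V₁ ∩ Minus2 s t) x y → Reach E (V ∩ Minus2 s t) x y
    lift = Reach-map (λ z (z₁ , z∉) → ≐∪-inj₁ V≐ z z₁ , z∉) (≐∪₂-inj₁ E≐)

    C₁ : VPred n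
    C₁ = Bridge₂ V₁ E₁ s t h

  C₁-SP : SP C₁ (Induced E₁ C₁) s t
  C₁-SP = let s₁ , t₁ = SP-separator-inside D₁ h∈ (¬h⇝u ∘ lift) (¬h⇝v ∘ lift)
          in bridges₁ s≢t s₁ t₁ h∈ (¬h⇝u ∘ lift) (¬h⇝v ∘ lift)

  avoids-V₂ : Reach E₁ (V₁ ∩ Minus2 s t) h x → ¬ V₂ x
  avoids-V₂ {x = x} r x₂ = [ (λ { refl → ¬h⇝u (lift r) }) , (λ { refl → ¬h⇝v (lift r) }) ]
                             (meet x (proj₁ (proj₂ (Reach-endpoints r))) x₂)

  C₁∩V₂ : C₁ z → V₂ z → Pair s t z
  C₁∩V₂ (inj₁ r) z₂ = ⊥-elim (avoids-V₂ r z₂)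
  C₁∩V₂ (inj₂ st) _ = st

  E₂-edge-in-C₁ : C₁ x → C₁ y → E₂ x y → (x ≡ s × y ≡ t) ⊎ (x ≡ t × y ≡ s)
  E₂-edge-in-C₁ x∈ y∈ e₂ with C₁∩V₂ x∈ (proj₁ (SP-edge-ends D₂ e₂)) | C₁∩V₂ y∈ (proj₂ (SP-edge-ends D₂ e₂))
  ... | inj₁ x≡s  | inj₂ y≡t  = inj₁ (x≡s , y≡t)
  ... | inj₂ x≡t  | inj₁ y≡s  = inj₂ (x≡t , y≡s)
  ... | inj₁ refl | inj₁ refl = ⊥-elim (SP-irrefl D₂ e₂)
  ... | inj₂ refl | inj₂ refl = ⊥-elim (SP-irrefl D₂ e₂)

  bridge-with-st-edge : E₂ s t → SP (Bridge₂ V E s t h) (Induced E (Bridge₂ V E s t h)) s t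
  bridge-with-st-edge st₂ =
    SP-induced (parallel C₁-SP (edge s≢t ≐-refl ≐₂-refl) (λ _ _ st → st) C₁≐C₁∪st ≐₂-refl)
               (Bridge₂-confined V≐ E≐ D₁ D₂ h∈ avoids-V₂)
               (λ x∈ y∈ e → [ inj₁ ∘ (λ e₁ → x∈ , y∈ , e₁) , inj₂ ∘ E₂-edge-in-C₁ x∈ y∈ ]′ (≐₂-to E≐ e))
               (λ x y → [ ≐∪₂-inj₁ E≐ x y ∘ proj₂ ∘ proj₂ , st-edge-in-E ])
    where
    C₁≐C₁∪st : C₁ ≐ (C₁ ∪ Pair s t)
    C₁≐C₁∪st z = inj₁ , [ id , inj₂ ]
    st-edge-in-E : (x ≡ s × y ≡ t) ⊎ (x ≡ t × y ≡ s) → E x y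
    st-edge-in-E (inj₁ (refl , refl)) = ≐∪₂-inj₂ E≐ s t st₂
    st-edge-in-E (inj₂ (refl , refl)) = ≐∪₂-inj₂ E≐ t s (SP-sym D₂ st₂)

  bridge-without-st-edge : ¬ E₂ s t → SP (Bridge₂ V E s t h) (Induced E (Bridge₂ V E s t h)) s t
  bridge-without-st-edge ¬st₂ =
    SP-induced C₁-SP (Bridge₂-confined V≐ E≐ D₁ D₂ h∈ avoids-V₂) inside (λ x y → ≐∪₂-inj₁ E≐ x y ∘ proj₂ ∘ proj₂)
    where
    inside : C₁ x → C₁ y → E x y → Induced E₁ C₁ x y
    inside x∈ y∈ e with ≐₂-to E≐ e
    ... | inj₁ e₁ = x∈ , y∈ , e₁
    ... | inj₂ e₂ with E₂-edge-in-C₁ x∈ y∈ e₂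
    ...   | inj₁ (refl , refl) = ⊥-elim (¬st₂ e₂)
    ...   | inj₂ (refl , refl) = ⊥-elim (¬st₂ (SP-sym D₂ e₂))

  bridge : SP (Bridge₂ V E s t h) (Induced E (Bridge₂ V E s t h)) s t
  bridge with SP-dec-E D₂ s t
  ... | yes st₂ = bridge-with-st-edge st₂
  ... | no ¬st₂ = bridge-without-st-edge ¬st₂

SP-bridge₂ : SP V E u v → Bridges₂AreSP V E u v
SP-bridge₂ (edge _ V≐ _) _ _ _ h∈@(Vh , _) ¬h⇝u ¬h⇝v with ≐-to V≐ Vh
... | inj₁ refl = ⊥-elim (¬h⇝u (here h∈))
... | inj₂ refl = ⊥-elim (¬h⇝v (here h∈))
SP-bridge₂ (series D₁ D₂ meet V≐ E≐) s≢t Vs Vt (Vh , h∉) ¬h⇝u ¬h⇝v with ≐-to V≐ Vh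
... | inj₁ h₁ = SeriesBridge₂.bridge-from-V₁ D₁ D₂ meet V≐ E≐ (SP-bridge₂ D₁) s≢t Vs Vt (h₁ , h∉) ¬h⇝u ¬h⇝v
... | inj₂ h₂ = SeriesBridge₂.bridge-from-V₁ (SP-reverse D₂) (SP-reverse D₁) (λ z z₂ z₁ → meet z z₁ z₂)
                  (≐-trans V≐ ∪-comm) (≐₂-trans E≐ ∪₂-comm) (Bridges₂AreSP-swap (SP-bridge₂ D₂))
                  s≢t Vs Vt (h₂ , h∉) ¬h⇝v ¬h⇝u
SP-bridge₂ (parallel D₁ D₂ meet V≐ E≐) s≢t _ _ (Vh , h∉) ¬h⇝u ¬h⇝v with ≐-to V≐ Vh
... | inj₁ h₁ = ParallelBridge₂.bridge D₁ D₂ meet V≐ E≐ (SP-bridge₂ D₁) s≢t (h₁ , h∉) ¬h⇝u ¬h⇝v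
... | inj₂ h₂ = ParallelBridge₂.bridge D₂ D₁ (λ z z₂ z₁ → meet z z₁ z₂) (≐-trans V≐ ∪-comm) (≐₂-trans E≐ ∪₂-comm)
                  (SP-bridge₂ D₂) s≢t (h₂ , h∉) ¬h⇝u ¬h⇝v

two-colouring : ∀ k → Fin n → ℤ[ k ]
two-colouring k zero    = zero
two-colouring k (suc _) = next k zero

colourable-≤2 : ∀ k → n ≤ 2 → (G : Graph n) → Colourable k (Graph.E G)
colourable-≤2 {n = n} k n≤2 G = two-colouring k , λ x y e → adjacent x y e n≤2
  where
  adjacent : ∀ x y → Graph.E G x y → n ≤ 2 → CAdj k (two-colouring k x) (two-colouring k y)
  adjacent zero zero e _                     = ⊥-elim (irrfl G zero e)
  adjacent zero (suc zero) _ _               = inj₁ refl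
  adjacent (suc zero) zero _ _               = inj₂ refl
  adjacent (suc zero) (suc zero) e _         = ⊥-elim (irrfl G _ e)
  adjacent (suc (suc ())) _ _ (s≤s (s≤s z≤n))
  adjacent _ (suc (suc ())) _ (s≤s (s≤s z≤n))

critical-induced-colourable : ∀ k {G : Graph n} → Critical k G → ¬ (∀ x → W x) →
                              Colourable k (Induced (Graph.E G) W)
critical-induced-colourable {W = W} k {G} (_ , proper-colourable) missing = proper-colourable H (missing ∘ proj₁)
  where
  H : Subgraph G
  H = record { V' = W ; E' = Induced (Graph.E G) W
             ; E'⊆E = λ _ _ → proj₂ ∘ proj₂ ; E'⊆V' = λ _ _ (Wx , Wy , _) → Wx , Wy }

record ParallelSplit (E : EPred n) (a b : Fin n) : Set₁ where
  field
    {Vˡ Vʳ} : VPred n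
    {Eˡ Eʳ} : EPred n
    Dˡ      : SP Vˡ Eˡ a b
    Dʳ      : SP Vʳ Eʳ a b
    meet    : ∀ z → Vˡ z → Vʳ z → Pair a b z
    V≐      : (λ _ → ⊤) ≐ (Vˡ ∪ Vʳ)
    E≐      : E ≐₂ (Eˡ ∪₂ Eʳ)

edge-colourable : ∀ k → s ≢ t → E ≐₂ (λ x y → (x ≡ s × y ≡ t) ⊎ (x ≡ t × y ≡ s)) → Colourable k E
edge-colourable {s = s} {t = t} {E = E} k s≢t E≐ = φ , colouring
  where
  φ = splice (_≟ s) (λ _ → zero) (λ _ → next k zero)
  φt≡next-φs : φ t ≡ next k (φ s)
  φt≡next-φs = trans (splice-≡ʳ (_≟ s) _ _ (inj₁ (s≢t ∘ sym)))
                     (cong (next k) (sym (splice-≡ˡ (_≟ s) _ _ (inj₁ refl))))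
  colouring : IsColouring k E φ
  colouring x y e with ≐₂-to E≐ e
  ... | inj₁ (refl , refl) = inj₁ φt≡next-φs
  ... | inj₂ (refl , refl) = inj₂ φt≡next-φs

-- Rotate the second colouring to agree with the first at m, then splice them along V₁.
series-colourable : ∀ k → SP V₁ E₁ s m → SP V₂ E₂ m t → (∀ z → V₁ z → V₂ z → z ≡ m) → E ≐₂ (E₁ ∪₂ E₂) →
                    Colourable k E₁ → Colourable k E₂ → Colourable k E
series-colourable {V₁ = V₁} {E₁ = E₁} {m = m} {V₂ = V₂} {E₂ = E₂} {E = E} k D₁ D₂ meet E≐ (φ , φ-col) (ψ₀ , ψ₀-col)
  with recolour k ψ₀-col m (φ m)
... | ψ , ψ-col , ψm≡φm = splice (SP-dec-V D₁) φ ψ , splice-isColouring k (SP-dec-V D₁) φ-col ψ-col sides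
  where
  agrees-on-V₂ : V₂ z → ¬ V₁ z ⊎ φ z ≡ ψ z
  agrees-on-V₂ {z = z} z₂ with SP-dec-V D₁ z
  ... | no z∉V₁ = inj₁ z∉V₁
  ... | yes z₁ rewrite meet z z₁ z₂ = inj₂ (sym ψm≡φm)
  sides : ∀ x y → E x y → (E₁ x y × (V₁ x ⊎ φ x ≡ ψ x) × (V₁ y ⊎ φ y ≡ ψ y))
                        ⊎ (E₂ x y × (¬ V₁ x ⊎ φ x ≡ ψ x) × (¬ V₁ y ⊎ φ y ≡ ψ y))
  sides x y e with ≐₂-to E≐ e
  ... | inj₁ e₁ = inj₁ (e₁ , inj₁ (proj₁ (SP-edge-ends D₁ e₁)) , inj₁ (proj₂ (SP-edge-ends D₁ e₁)))
  ... | inj₂ e₂ = inj₂ (e₂ , agrees-on-V₂ (proj₁ (SP-edge-ends D₂ e₂)) , agrees-on-V₂ (proj₂ (SP-edge-ends D₂ e₂)))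

critical-SP-parallel : ∀ k {G : Graph n} → Critical k G → SP (λ _ → ⊤) (Graph.E G) u v → ParallelSplit (Graph.E G) u v
critical-SP-parallel _ _ (parallel D₁ D₂ meet V≐ E≐) = record { Dˡ = D₁ ; Dʳ = D₂ ; meet = meet ; V≐ = V≐ ; E≐ = E≐ }
critical-SP-parallel k (uncolourable , _) (edge u≢v _ E≐) = ⊥-elim (uncolourable (edge-colourable k u≢v E≐))
critical-SP-parallel {n = n} k {G} critical@(uncolourable , _) (series {s = a} {t = b} D₁ D₂ meet V≐ E≐) =
  ⊥-elim (uncolourable (series-colourable k D₁ D₂ meet E≐
    (part-colourable D₁ (≐∪₂-inj₁ E≐) λ all → SP-terminals-distinct D₂ (sym (meet b (all b) (SP-target D₂))))
    (part-colourable D₂ (≐∪₂-inj₂ E≐) λ all → SP-terminals-distinct D₁ (meet a (SP-source D₁) (all a)))))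
  where
  part-colourable : {W : VPred n} {F : EPred n} {a′ b′ : Fin n} → SP W F a′ b′ → F ⊆₂ Graph.E G → ¬ (∀ x → W x) →
                    Colourable k F
  part-colourable D F⊆E missing =
    Colourable-mono {k = k} (λ x y f → proj₁ (SP-edge-ends D f) , proj₂ (SP-edge-ends D f) , F⊆E x y f)
                            (critical-induced-colourable k critical missing)

critical-more-than-2-vertices : ∀ k {G : Graph n} → Critical k G → 3 ≤ n
critical-more-than-2-vertices {n = n} k {G} (uncolourable , _) with 3 ≤? n
... | yes 3≤n = 3≤n
... | no 3≰n  = ⊥-elim (uncolourable (colourable-≤2 k (s≤s⁻¹ (≰⇒> 3≰n)) G))

module _ {n : ℕ} {E : EPred n} {a b : Fin n} (split : ParallelSplit E a b) where
  open ParallelSplit split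

  private
    D : SP (λ _ → ⊤) E a b
    D = parallel Dˡ Dʳ meet V≐ E≐

  ParallelSplit-reroot : E x y → SP (λ _ → ⊤) E x y
  ParallelSplit-reroot e with ≐₂-to E≐ e
  ... | inj₁ eˡ = SP-resp (≐-sym V≐) (≐₂-sym E≐) (SP-reroot Dˡ eˡ Dʳ meet)
  ... | inj₂ eʳ = SP-resp (≐-sym (≐-trans V≐ ∪-comm)) (≐₂-sym (≐₂-trans E≐ ∪₂-comm))
                          (SP-reroot Dʳ eʳ Dˡ λ z zʳ zˡ → meet z zˡ zʳ)

  ParallelSplit-terminals-linked : ∀ x → a ≢ x → b ≢ x → Reach E ((λ _ → ⊤) ∖ x) a b
  ParallelSplit-terminals-linked x a≢x b≢x with SP-dec-V Dˡ x
  ... | no x∉Vˡ  = Reach-map (λ z zˡ → tt , λ { refl → x∉Vˡ zˡ }) (≐∪₂-inj₁ E≐) (SP-reaches-target Dˡ (SP-source Dˡ))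
  ... | yes x∈Vˡ = Reach-map (λ z zʳ → tt , λ { refl → [ a≢x ∘ sym , b≢x ∘ sym ] (meet z x∈Vˡ zʳ) }) (≐∪₂-inj₂ E≐)
                             (SP-reaches-target Dʳ (SP-source Dʳ))

  ParallelSplit-hub : ∀ x → ∃ λ c → ∀ {w} → w ≢ x → Reach E ((λ _ → ⊤) ∖ x) w c
  ParallelSplit-hub x with a ≟ x | b ≟ x
  ... | yes refl | _       = b , λ w≢x → [ ⊥-elim ∘ ¬Reach-removed , id ]′ (SP-avoid D (tt , w≢x))
  ... | no a≢x   | yes refl = a , λ w≢x → [ id , ⊥-elim ∘ ¬Reach-removed ]′ (SP-avoid D (tt , w≢x))
  ... | no a≢x   | no b≢x   = a , λ w≢x →
    [ id , (λ r → Reach-trans r (Reach-sym (λ _ _ → SP-sym D) (ParallelSplit-terminals-linked x a≢x b≢x))) ]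
    (SP-avoid D (tt , w≢x))

two-connected : ∀ k {G : Graph n} → Critical k G → SP (λ _ → ⊤) (Graph.E G) u v → TwoConnected G
two-connected k {G} critical D =
  critical-more-than-2-vertices k critical , (λ x y _ _ → SP-connected D tt tt) , connected-minus
  where
  connected-minus : ∀ x → Connected G (λ y → y ≢ x)
  connected-minus x y z y≢x z≢x =
    let c , hub = ParallelSplit-hub (critical-SP-parallel k critical D) x
    in Reach-map (λ _ → proj₂) ⊆₂-refl (Reach-trans (hub y≢x) (Reach-sym (Graph.sym G) (hub z≢x)))

module TwoCut {n : ℕ} (k : ℕ) (G : Graph n) (critical : Critical k G) {a b : Fin n}
              (D₀ : SP (λ _ → ⊤) (Graph.E G) a b) (s t : Fin n) (cut : VertexCut G s t)
              (h : Fin n) (h∈ : Minus2 s t h) where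

  private
    G-sym : ∀ x y → Graph.E G x y → Graph.E G y x
    G-sym = Graph.sym G
    Comp : Fin n → VPred n
    Comp = Component G s t
    Comp? : ∀ x → Decidable (Comp x)
    Comp? x = Reach-dec (SP-dec-E D₀) Minus2-dec x
    Bridge : VPred n
    Bridge = Comp h ∪ Pair s t

  outside-vertex : ∃ λ h′ → Minus2 s t h′ × ¬ Comp h h′
  outside-vertex with ¬∀⟶∃¬ n (λ w → Minus2 s t w → Comp h w) (λ w → Minus2-dec w →-dec Comp? h w) not-all
    where
    not-all : ¬ (∀ w → Minus2 s t w → Comp h w)
    not-all all = proj₂ cut λ u v u∈ v∈ → Reach-trans (Reach-sym G-sym (all u u∈)) (all v v∈)
  ... | w , ¬w with Minus2-dec w
  ...   | yes w∈ = w , w∈ , λ c → ¬w λ _ → c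
  ...   | no w∉  = ⊥-elim (¬w (⊥-elim ∘ w∉))

  -- The first edge leaving another component of G − {s, t}, on a path towards h, starts at s or t.
  exit-edge : ∃ λ q → ∃ λ p → Pair s t q × Graph.E G q p × ¬ Comp h p
  exit-edge with outside-vertex
  ... | h′ , h′∈ , h′∉ with Reach-exit (Comp h′) (Comp? h′) (SP-connected D₀ tt tt) (here h′∈) (h′∉ ∘ Reach-sym G-sym)
  ...   | p , q , p∈ , q∉ , e , _ =
    q , p , [ ⊥-elim ∘ q∉ ∘ step p∈ e , id ]′ (Minus2-or-Pair q) , G-sym p q e ,
    λ h⇝p → h′∉ (Reach-trans h⇝p (Reach-sym G-sym p∈))

  -- Rerooted at the exit edge q p, the decomposition has terminals that the component of h cannot reach.
  bridge-SP : SP Bridge (InducedE G Bridge) s t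
  bridge-SP with exit-edge
  ... | q , p , q∈st , e , p∉ =
    SP-resp Bridge≐ (Induced-≐ Bridge≐)
      (SP-bridge₂ (ParallelSplit-reroot (critical-SP-parallel k critical D₀) e) (proj₁ cut) tt tt (tt , h∈)
                  (λ r → let _ , q≢s , q≢t = proj₂ (Reach-endpoints r) in [ q≢s , q≢t ] q∈st)
                  (p∉ ∘ Reach-map (λ _ → proj₂) ⊆₂-refl))
    where
    Bridge≐ : Bridge₂ (λ _ → ⊤) (Graph.E G) s t h ≐ Bridge
    Bridge≐ z = [ inj₁ ∘ Reach-map (λ _ → proj₂) ⊆₂-refl , inj₂ ]
              , [ inj₁ ∘ Reach-map (λ _ → tt ,_) ⊆₂-refl , inj₂ ]

  forced-colour : ∃ λ x → Forced k (InducedE G Bridge) s t x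
  forced-colour with outside-vertex
  ... | h′ , (h′≢s , h′≢t) , h′∉ with critical-induced-colourable {W = Bridge} k critical
                                         (λ all → [ h′∉ , [ h′≢s , h′≢t ]′ ]′ (all h′))
  ...   | φ₀ , φ₀-col with recolour k φ₀-col s zero
  ...     | φ , φ-col , φs≡0 = φ t , φ , φ-col , φs≡0 , refl

  glue-at-cut : {χ ψ : Fin n → ℤ[ k ]} → IsColouring k (InducedE G Bridge) χ →
                IsColouring k (Induced (Graph.E G) (λ z → ¬ Comp h z)) ψ →
                χ s ≡ ψ s → χ t ≡ ψ t → Colourable k (Graph.E G)
  glue-at-cut {χ} {ψ} χ-col ψ-col χs≡ψs χt≡ψt =
    splice (Comp? h) χ ψ , splice-isColouring k (Comp? h) χ-col ψ-col sides
    where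
    agree : Pair s t y → χ y ≡ ψ y
    agree (inj₁ refl) = χs≡ψs
    agree (inj₂ refl) = χt≡ψt
    Side : Fin n → Fin n → Set
    Side x y = (InducedE G Bridge x y × (Comp h x ⊎ χ x ≡ ψ x) × (Comp h y ⊎ χ y ≡ ψ y))
             ⊎ (Induced (Graph.E G) (λ z → ¬ Comp h z) x y × (¬ Comp h x ⊎ χ x ≡ ψ x) × (¬ Comp h y ⊎ χ y ≡ ψ y))
    sides : ∀ x y → Graph.E G x y → Side x y
    sides x y e with Comp? h x | Comp? h y
    ... | yes x∈ | yes y∈ = inj₁ ((inj₁ x∈ , inj₁ y∈ , e) , inj₁ x∈ , inj₁ y∈)
    ... | no x∉  | no y∉  = inj₂ ((x∉ , y∉ , e) , inj₁ x∉ , inj₁ y∉)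
    ... | yes x∈ | no y∉  = [ (λ y∈ → ⊥-elim (y∉ (step x∈ e y∈)))
                            , (λ y∈st → inj₁ ((inj₁ x∈ , inj₂ y∈st , e) , inj₁ x∈ , inj₂ (agree y∈st))) ]′
                            (Minus2-or-Pair y)
    ... | no x∉  | yes y∈ = [ (λ x∈ → ⊥-elim (x∉ (step y∈ (G-sym x y e) x∈)))
                            , (λ x∈st → inj₁ ((inj₂ x∈st , inj₁ y∈ , e) , inj₂ (agree x∈st) , inj₁ y∈)) ]′
                            (Minus2-or-Pair x)

  unforced-colour : ∃ λ x → ¬ Forced k (InducedE G Bridge) s t x
  unforced-colour with critical-induced-colourable {W = λ z → ¬ Comp h z} k critical (λ all → all h (here h∈))
  ... | ψ₀ , ψ₀-col with recolour k ψ₀-col s zero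
  ...   | ψ , ψ-col , ψs≡0 =
    ψ t , λ (χ , χ-col , χs≡0 , χt≡ψt) → proj₁ critical (glue-at-cut χ-col ψ-col (trans χs≡0 (sym ψs≡0)) χt≡ψt)

lemma2p2 : (k : ℕ) → 1 ≤ k → {n : ℕ} → (G : Graph n)
    → Critical k G → SeriesParallel G
    → TwoConnected G
      × ((s t : Fin n) → VertexCut G s t
         → (h : Fin n) → Minus2 s t h
         → SP (Component G s t h ∪ (λ x → x ≡ s ⊎ x ≡ t))
              (InducedE G (Component G s t h ∪ (λ x → x ≡ s ⊎ x ≡ t))) s t
           × Restricted k (InducedE G (Component G s t h ∪ (λ x → x ≡ s ⊎ x ≡ t))) s t)
lemma2p2 k _ G critical (_ , _ , D₀) =
  two-connected k critical D₀ ,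
  λ s t cut h h∈ → let open TwoCut k G critical D₀ s t cut h h∈ in bridge-SP , forced-colour , unforced-colour
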